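{- Let $G$ be a candidate and let $C$ be a shortest odd hole in $G$. Then every $C$-major vertex has at least four neighbours in $V(C)$.
   Context: All graphs are finite and simple; the length of a path or cycle is its number of edges; the interior of a path is the set of its vertices that are not ends. A hole of $G$ is an induced subgraph that is a cycle of length at least four; an odd hole is a hole of odd length; a shortest odd hole of $G$ is an odd hole of $G$ with the minimum number of vertices among all odd holes of $G$. For a hole $C$ of $G$, a vertex $v$ of $G$ is $C$-major if there is no three-vertex path of $C$ containing all the neighbours of $v$ in $V(C)$. A shortest odd hole $C$ is heavy-cleanable if there is an edge $uv$ of $C$ such that every $C$-major vertex is adjacent to at least one of $u,v$. A pyramid in $G$ is an induced subgraph $G[V(P_1\cup P_2\cup P_3)]$ where $v_0,v_1,v_2,v_3$ are vertices and for $i=1,2,3$, $P_i$ is an induced path of $G$ between $v_0$ and $v_i$, such that: $P_1,P_2,P_3$ are pairwise vertex-disjoint except for $v_0$; $v_1,v_2,v_3\neq v_0$ and at least two of $P_1,P_2,P_3$ have length at least two; $v_1,v_2,v_3$ are pairwise adjacent; and for $1\le i<j\le 3$ the only edge between $V(P_i)\setminus\{v_0\}$ and $V(P_j)\setminus\{v_0\}$ is $v_iv_j$. A jewel in $G$ is an induced subgraph $G[V(P)\cup\{v_1,\dots,v_5\}]$ where $v_1,\dots,v_5$ are distinct vertices, $v_1v_2,v_2v_3,v_3v_4,v_4v_5,v_5v_1$ are edges, $v_1v_3,v_2v_4,v_1v_4$ are nonedges, and $P$ is a path of $G$ between $v_1$ and $v_4$ such that none of $v_2,v_3,v_5$ has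 a neighbour in the interior of $P$. A graph $G$ is a candidate if it contains no pyramid, no jewel, and no heavy-cleanable shortest odd hole. -}

module Defs where

open import Data.Nat using (ℕ; zero; suc; _+_; _≤_; _<_)
open import Data.Nat.Properties using ()
open import Data.Fin using (Fin; toℕ; fromℕ)
import Data.Fin as Fin
open import Data.Bool using (Bool; true; false)
open import Data.List using (List; length; filterᵇ; allFin)
open import Data.Product using (Σ; ∃; _×_; _,_)
open import Data.Sum using (_⊎_)
open import Relation.Binary.PropositionalEquality using (_≡_; _≢_)
open import Relation.Nullary using (¬_)
open import Function.Definitions using (Injective)

record Graph : Set where
  field
    n      : ℕ
    adj    : Fin n → Fin n → Bool
    sym    : ∀ u v → adj u v ≡ adj v u
    irrefl : ∀ v → adj v v ≡ false

module _ (G : Graph) where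
  open Graph G

  V : Set
  V = Fin n

  Adj : V → V → Set
  Adj u v = adj u v ≡ true

  record Path (k : ℕ) : Set where
    field
      vtx    : Fin (suc k) → V
      inj    : Injective _≡_ _≡_ vtx
      consec : ∀ (i j : Fin (suc k)) → suc (toℕ i) ≡ toℕ j → Adj (vtx i) (vtx j)

  record InducedPath (k : ℕ) : Set where
    field
      path    : Path k
    open Path path public
    field
      noChord : ∀ (i j : Fin (suc k)) → Adj (vtx i) (vtx j) →
                suc (toℕ i) ≡ toℕ j ⊎ suc (toℕ j) ≡ toℕ i

  -- Holes.  A hole of length m >= 4 is an injective labelling
  -- c : Fin m → V such that c i, c j adjacent in G iff i, j are
  -- consecutive modulo m (i.e. the induced subgraph is a cycle).

  CycAdj : (m : ℕ) → Fin m → Fin m → Set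
  CycAdj m i j =
      suc (toℕ i) ≡ toℕ j
    ⊎ suc (toℕ j) ≡ toℕ i
    ⊎ (toℕ i ≡ 0 × suc (toℕ j) ≡ m)
    ⊎ (toℕ j ≡ 0 × suc (toℕ i) ≡ m)

  record Hole : Set where
    field
      len     : ℕ
      len≥4   : 4 ≤ len
      cyc     : Fin len → V
      inj     : Injective _≡_ _≡_ cyc
      edges   : ∀ i j → CycAdj len i j → Adj (cyc i) (cyc j)
      induced : ∀ i j → Adj (cyc i) (cyc j) → CycAdj len i j

  Odd : ℕ → Set
  Odd m = ∃ λ k → m ≡ suc (k + k)

  OddHole : Hole → Set
  OddHole C = Odd (Hole.len C)

  ShortestOddHole : Hole → Set
  ShortestOddHole C = OddHole C × (∀ (D : Hole) → OddHole D → Hole.len C ≤ Hole.len D)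

  Major : Hole → V → Set
  Major C v = ¬ (Σ (Fin len) λ a → Σ (Fin len) λ b → Σ (Fin len) λ d →
                   CycAdj len a b × CycAdj len b d × a ≢ d ×
                   (∀ j → Adj v (cyc j) → j ≡ a ⊎ j ≡ b ⊎ j ≡ d))
    where open Hole C

  -- number of neighbours of v in V(C) (cyc is injective)
  numNbrsIn : Hole → V → ℕ
  numNbrsIn C v = length (filterᵇ (λ j → adj v (cyc j)) (allFin len))
    where open Hole C

  HeavyCleanable : Hole → Set
  HeavyCleanable C = Σ (Fin len) λ i → Σ (Fin len) λ j →
                       Adj (cyc i) (cyc j) ×
                       (∀ x → Major C x → Adj x (cyc i) ⊎ Adj x (cyc j))
    where open Hole C

  record Pyramid : Set where
    field
      k₁ k₂ k₃ : ℕ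
      P₁ : InducedPath k₁
      P₂ : InducedPath k₂
      P₃ : InducedPath k₃
    v₀₁ = InducedPath.vtx P₁ Fin.zero
    v₀₂ = InducedPath.vtx P₂ Fin.zero
    v₀₃ = InducedPath.vtx P₃ Fin.zero
    v₁ = InducedPath.vtx P₁ (fromℕ k₁)
    v₂ = InducedPath.vtx P₂ (fromℕ k₂)
    v₃ = InducedPath.vtx P₃ (fromℕ k₃)
    field
      same₀₂ : v₀₂ ≡ v₀₁
      same₀₃ : v₀₃ ≡ v₀₁
      -- v_i ≠ v0
      k₁≥1 : 1 ≤ k₁
      k₂≥1 : 1 ≤ k₂
      k₃≥1 : 1 ≤ k₃
      twoLong : (2 ≤ k₁ × 2 ≤ k₂) ⊎ (2 ≤ k₁ × 2 ≤ k₃) ⊎ (2 ≤ k₂ × 2 ≤ k₃)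
      disj₁₂ : ∀ a b → InducedPath.vtx P₁ a ≡ InducedPath.vtx P₂ b → toℕ a ≡ 0 × toℕ b ≡ 0
      disj₁₃ : ∀ a b → InducedPath.vtx P₁ a ≡ InducedPath.vtx P₃ b → toℕ a ≡ 0 × toℕ b ≡ 0
      disj₂₃ : ∀ a b → InducedPath.vtx P₂ a ≡ InducedPath.vtx P₃ b → toℕ a ≡ 0 × toℕ b ≡ 0
      e₁₂ : Adj v₁ v₂
      e₁₃ : Adj v₁ v₃
      e₂₃ : Adj v₂ v₃
      only₁₂ : ∀ a b → 1 ≤ toℕ a → 1 ≤ toℕ b →
               Adj (InducedPath.vtx P₁ a) (InducedPath.vtx P₂ b) → toℕ a ≡ k₁ × toℕ b ≡ k₂
      only₁₃ : ∀ a b → 1 ≤ toℕ a → 1 ≤ toℕ b →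
               Adj (InducedPath.vtx P₁ a) (InducedPath.vtx P₃ b) → toℕ a ≡ k₁ × toℕ b ≡ k₃
      only₂₃ : ∀ a b → 1 ≤ toℕ a → 1 ≤ toℕ b →
               Adj (InducedPath.vtx P₂ a) (InducedPath.vtx P₃ b) → toℕ a ≡ k₂ × toℕ b ≡ k₃

  record Jewel : Set where
    field
      v₁ v₂ v₃ v₄ v₅ : V
      d₁₂ : v₁ ≢ v₂
      d₁₃ : v₁ ≢ v₃
      d₁₄ : v₁ ≢ v₄
      d₁₅ : v₁ ≢ v₅
      d₂₃ : v₂ ≢ v₃
      d₂₄ : v₂ ≢ v₄
      d₂₅ : v₂ ≢ v₅
      d₃₄ : v₃ ≢ v₄
      d₃₅ : v₃ ≢ v₅
      d₄₅ : v₄ ≢ v₅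
      e₁₂ : Adj v₁ v₂
      e₂₃ : Adj v₂ v₃
      e₃₄ : Adj v₃ v₄
      e₄₅ : Adj v₄ v₅
      e₅₁ : Adj v₅ v₁
      n₁₃ : ¬ Adj v₁ v₃
      n₂₄ : ¬ Adj v₂ v₄
      n₁₄ : ¬ Adj v₁ v₄
      k : ℕ
      P : Path k
      start : Path.vtx P Fin.zero ≡ v₁
      end   : Path.vtx P (fromℕ k) ≡ v₄
      clean : ∀ (i : Fin (suc k)) → 1 ≤ toℕ i → toℕ i < k →
              ¬ Adj v₂ (Path.vtx P i) × ¬ Adj v₃ (Path.vtx P i) × ¬ Adj v₅ (Path.vtx P i)

  HasHeavyCleanableShortestOddHole : Set
  HasHeavyCleanableShortestOddHole =
    Σ Hole λ C → ShortestOddHole C × HeavyCleanable C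

  Candidate : Set
  Candidate = ¬ Pyramid × ¬ Jewel × ¬ HasHeavyCleanableShortestOddHole

-- A major vertex x is not on C. Suppose it had at most three neighbours on C: they sit at
-- positions s, s + g₁, s + g₁ + g₂ modulo |C|, with g₁ + g₂ + g₃ = |C| (a gap may be 0), and
-- as |C| is odd some gap is odd. If two cyclically consecutive gaps sum to at most 2, all
-- neighbours lie on a three-vertex path of C, so x is not major. Otherwise an odd gap g ≥ 3
-- is an induced path of C that x closes into an odd hole of length g + 2 < |C|, and a gap 1
-- (the other two being at least 2) makes x and that edge of C a triangle which, together
-- with the two arcs of C from the third neighbour, forms a pyramid.

module Submission where

open import Data.Bool using (T; T?)
open import Data.Bool.Properties using (T-≡)
open import Data.Empty using (⊥; ⊥-elim)
open import Data.Fin using (Fin; toℕ; fromℕ; opposite) renaming (zero to fzero; suc to fsuc)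
import Data.Fin as Fin
open import Data.Fin.Properties
  using (toℕ-injective; toℕ-fromℕ; toℕ-fromℕ<; toℕ<n; opposite-prop; opposite-involutive)
open import Data.List using (List; []; _∷_; length; filterᵇ; allFin)
open import Data.List.Membership.Propositional using (_∈_)
open import Data.List.Membership.Propositional.Properties using (∈-filter⁺; ∈-filter⁻; ∈-allFin)
open import Data.List.Relation.Unary.All using ([]; _∷_)
open import Data.List.Relation.Unary.AllPairs using (AllPairs; []; _∷_)
open import Data.List.Relation.Unary.AllPairs.Properties using (filter⁺; tabulate⁺-<)
open import Data.List.Relation.Unary.Any using (here; there)
open import Data.List.Relation.Unary.Any.Properties using (¬Any[])
open import Data.Nat
open import Data.Nat.DivMod
open import Data.Nat.Properties
open import Data.Nat.Solver using (module +-*-Solver)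
open import Data.Product using (∃; _×_; _,_; proj₁; proj₂)
open import Data.Sum using (_⊎_; inj₁; inj₂)
open import Function using (_∘_; id)
open import Function.Bundles using (Equivalence)
open import Relation.Binary.PropositionalEquality
open import Relation.Nullary using (¬_; Dec; yes; no)

open import Defs

open +-*-Solver using (solve; _:+_; _:=_; con)

-- CycAdj G m i j unfolds to Consecutive m (toℕ i) (toℕ j).
Consecutive : ℕ → ℕ → ℕ → Set
Consecutive m a b = suc a ≡ b ⊎ suc b ≡ a ⊎ (a ≡ 0 × suc b ≡ m) ⊎ (b ≡ 0 × suc a ≡ m)

Consecutive-sym : ∀ {m a b} → Consecutive m a b → Consecutive m b a
Consecutive-sym (inj₁ e) = inj₂ (inj₁ e)
Consecutive-sym (inj₂ (inj₁ e)) = inj₁ e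
Consecutive-sym (inj₂ (inj₂ (inj₁ e))) = inj₂ (inj₂ (inj₂ e))
Consecutive-sym (inj₂ (inj₂ (inj₂ e))) = inj₂ (inj₂ (inj₁ e))

module _ {m : ℕ} .{{_ : NonZero m}} where

  %-absorbˡ : ∀ a b → (a % m + b) % m ≡ (a + b) % m
  %-absorbˡ a b = begin
    (a % m + b) % m          ≡⟨ %-distribˡ-+ (a % m) b m ⟩
    (a % m % m + b % m) % m  ≡⟨ cong (λ z → (z + b % m) % m) (m%n%n≡m%n a m) ⟩
    (a % m + b % m) % m      ≡⟨ sym (%-distribˡ-+ a b m) ⟩
    (a + b) % m              ∎
    where open ≡-Reasoning

  -- Adding m ∸ s % m completes s to a multiple of m.
  %-cancelʳ-+ : ∀ s {a b} → (a + s) % m ≡ (b + s) % m → a % m ≡ b % m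
  %-cancelʳ-+ s {a} {b} e = begin
    a % m                          ≡⟨ undo a ⟩
    ((a + s) % m + d) % m          ≡⟨ cong (λ z → (z + d) % m) e ⟩
    ((b + s) % m + d) % m          ≡⟨ sym (undo b) ⟩
    b % m                          ∎
    where
    open ≡-Reasoning
    d = m ∸ s % m
    complete : s + d ≡ suc (s / m) * m
    complete = begin
      s + d                        ≡⟨ cong (_+ d) (m≡m%n+[m/n]*n s m) ⟩
      s % m + (s / m) * m + d      ≡⟨ cong (_+ d) (+-comm (s % m) _) ⟩
      (s / m) * m + s % m + d      ≡⟨ +-assoc ((s / m) * m) (s % m) d ⟩
      (s / m) * m + (s % m + d)    ≡⟨ cong ((s / m) * m +_) (m+[n∸m]≡n (m%n≤n s m)) ⟩
      (s / m) * m + m              ≡⟨ +-comm ((s / m) * m) m ⟩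
      suc (s / m) * m              ∎
    undo : ∀ a → a % m ≡ ((a + s) % m + d) % m
    undo a = begin
      a % m                        ≡⟨ sym ([m+kn]%n≡m%n a (suc (s / m)) m) ⟩
      (a + suc (s / m) * m) % m    ≡⟨ cong (λ z → (a + z) % m) (sym complete) ⟩
      (a + (s + d)) % m            ≡⟨ cong (_% m) (sym (+-assoc a s d)) ⟩
      (a + s + d) % m              ≡⟨ sym (%-absorbˡ (a + s) d) ⟩
      ((a + s) % m + d) % m        ∎

  toℕ-mod : ∀ a → toℕ (a mod m) ≡ a % m
  toℕ-mod a = toℕ-fromℕ< (m%n<n a m)

  mod-≡ : ∀ {a b} → a % m ≡ b % m → a mod m ≡ b mod m
  mod-≡ {a} {b} e = toℕ-injective (trans (toℕ-mod a) (trans e (sym (toℕ-mod b))))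

  mod-≡⁻ : ∀ {a b} → a mod m ≡ b mod m → a % m ≡ b % m
  mod-≡⁻ {a} {b} e = trans (sym (toℕ-mod a)) (trans (cong toℕ e) (toℕ-mod b))

  mod-cancelʳ-+ : ∀ s {a b} → (a + s) mod m ≡ (b + s) mod m → a mod m ≡ b mod m
  mod-cancelʳ-+ s = mod-≡ ∘ %-cancelʳ-+ s ∘ mod-≡⁻

  mod-cancelˡ-+ : ∀ s {a b} → (s + a) mod m ≡ (s + b) mod m → a mod m ≡ b mod m
  mod-cancelˡ-+ s {a} {b} e =
    mod-cancelʳ-+ s (subst₂ (λ x y → x mod m ≡ y mod m) (+-comm s a) (+-comm s b) e)

  mod-injective : ∀ {a b} → a < m → b < m → a mod m ≡ b mod m → a ≡ b
  mod-injective a<m b<m e = trans (sym (m<n⇒m%n≡m a<m)) (trans (mod-≡⁻ e) (m<n⇒m%n≡m b<m))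

  mod-toℕ : ∀ (j : Fin m) → toℕ j mod m ≡ j
  mod-toℕ j = toℕ-injective (trans (toℕ-mod (toℕ j)) (m<n⇒m%n≡m (toℕ<n j)))

  mod-periodic : ∀ a → (m + a) mod m ≡ a mod m
  mod-periodic a = mod-≡ (trans (cong (_% m) (+-comm m a)) ([m+n]%n≡m%n a m))

  mod-self : m mod m ≡ 0 mod m
  mod-self = mod-≡ (trans (n%n≡0 m) (sym (m<n⇒m%n≡m (>-nonZero⁻¹ m))))

  suc-mod-toℕ : ∀ a → suc (toℕ (a mod m)) mod m ≡ suc a mod m
  suc-mod-toℕ a = mod-≡ (trans (cong (λ z → suc z % m) (toℕ-mod a)) (trans (cong (_% m) (+-comm 1 (a % m)))
                    (trans (%-absorbˡ a 1) (cong (_% m) (+-comm a 1)))))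

  suc-mod-cases : ∀ {a b} → a < m → b < m → suc a mod m ≡ b mod m →
                  suc a ≡ b ⊎ (b ≡ 0 × suc a ≡ m)
  suc-mod-cases {a} a<m b<m e with suc a <? m
  ... | yes 1+a<m = inj₁ (mod-injective 1+a<m b<m e)
  ... | no 1+a≮m  =
    inj₂ (mod-injective b<m (>-nonZero⁻¹ m) (trans (sym e) (trans (cong (_mod m) 1+a≡m) mod-self)) , 1+a≡m)
    where 1+a≡m = ≤-antisym a<m (≮⇒≥ 1+a≮m)

  mod-endpoint : ∀ {t g u} → g < m → t ≤ g → g ≤ u → u ≤ m → t mod m ≡ u mod m →
                 t ≡ 0 ⊎ t ≡ g
  mod-endpoint {t} {g} {u} g<m t≤g g≤u u≤m e with m≤n⇒m<n∨m≡n u≤m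
  ... | inj₁ u<m = inj₂ (≤-antisym t≤g (subst (g ≤_) (sym (mod-injective t<m u<m e)) g≤u))
    where t<m = ≤-<-trans t≤g g<m
  ... | inj₂ refl = inj₁ (mod-injective (≤-<-trans t≤g g<m) (>-nonZero⁻¹ m) (trans e mod-self))

  Consecutive-mod-suc : ∀ a → Consecutive m (toℕ (a mod m)) (toℕ (suc a mod m))
  Consecutive-mod-suc a with suc (toℕ (a mod m)) <? m
  ... | yes 1+r<m = inj₁ (sym (mod-injective (toℕ<n (suc a mod m)) 1+r<m
                              (trans (mod-toℕ (suc a mod m)) (sym (suc-mod-toℕ a)))))
  ... | no 1+r≮m =
    inj₂ (inj₂ (inj₂ (mod-injective (toℕ<n (suc a mod m)) (>-nonZero⁻¹ m) wraps , 1+r≡m)))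
    where
    1+r≡m = ≤-antisym (toℕ<n (a mod m)) (≮⇒≥ 1+r≮m)
    wraps : toℕ (suc a mod m) mod m ≡ 0 mod m
    wraps = trans (mod-toℕ _) (trans (sym (suc-mod-toℕ a)) (trans (cong (_mod m) 1+r≡m) mod-self))

  Consecutive⇒suc-mod : ∀ {i j : Fin m} → Consecutive m (toℕ i) (toℕ j) →
                        suc (toℕ i) mod m ≡ j ⊎ suc (toℕ j) mod m ≡ i
  Consecutive⇒suc-mod {i} {j} (inj₁ e) = inj₁ (trans (cong (_mod m) e) (mod-toℕ j))
  Consecutive⇒suc-mod {i} {j} (inj₂ (inj₁ e)) = inj₂ (trans (cong (_mod m) e) (mod-toℕ i))
  Consecutive⇒suc-mod {i} {j} (inj₂ (inj₂ (inj₁ (i≡0 , e)))) =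
    inj₂ (trans (cong (_mod m) e) (trans mod-self (trans (cong (_mod m) (sym i≡0)) (mod-toℕ i))))
  Consecutive⇒suc-mod {i} {j} (inj₂ (inj₂ (inj₂ (j≡0 , e)))) =
    inj₁ (trans (cong (_mod m) e) (trans mod-self (trans (cong (_mod m) (sym j≡0)) (mod-toℕ j))))

Even : ℕ → Set
Even n = ∃ λ k → n ≡ k + k

Even-+ : ∀ {a b} → Even a → Even b → Even (a + b)
Even-+ {a} {b} (k , refl) (l , refl) = k + l , solve 2 (λ k l → k :+ k :+ (l :+ l) := k :+ l :+ (k :+ l)) refl k l

double≢suc-double : ∀ k l → k + k ≢ suc (l + l)
double≢suc-double zero l ()
double≢suc-double (suc k) zero e with () ← trans (sym (+-suc k k)) (suc-injective e)
double≢suc-double (suc k) (suc l) e =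
  double≢suc-double k l (suc-injective (trans (sym (+-suc k k)) (trans (suc-injective e) (cong suc (+-suc l l)))))

-- Odd is declared inside the graph module of Defs, so it carries an unused graph argument.
module _ {G : Graph} where

  even-or-odd : ∀ n → Even n ⊎ Odd G n
  even-or-odd zero = inj₁ (0 , refl)
  even-or-odd (suc n) with even-or-odd n
  ... | inj₁ (k , e) = inj₂ (k , cong suc e)
  ... | inj₂ (k , e) = inj₁ (suc k , cong suc (trans e (sym (+-suc k k))))

  even-not-odd : ∀ {n} → Even n → ¬ Odd G n
  even-not-odd (k , e) (l , f) = double≢suc-double k l (trans (sym e) f)

  Odd-+2 : ∀ {n} → Odd G n → Odd G (suc (suc n))
  Odd-+2 (k , e) = suc k , cong (suc ∘ suc) (trans e (sym (+-suc k k)))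

opposite-consecutive : ∀ {k} {i j : Fin (suc k)} → suc (toℕ i) ≡ toℕ j →
                       suc (toℕ (opposite j)) ≡ toℕ (opposite i)
opposite-consecutive {k} {i} {j} e = begin
  suc (toℕ (opposite j))  ≡⟨ cong suc (opposite-prop j) ⟩
  suc (k ∸ toℕ j)         ≡⟨ sym (+-∸-assoc 1 (≤-pred (toℕ<n j))) ⟩
  suc k ∸ toℕ j           ≡⟨ cong (suc k ∸_) (sym e) ⟩
  k ∸ toℕ i               ≡⟨ sym (opposite-prop i) ⟩
  toℕ (opposite i)        ∎
  where open ≡-Reasoning

module _ {G : Graph} where

  Adj-sym : ∀ {u w} → Adj G u w → Adj G w u
  Adj-sym {u} {w} = trans (Graph.sym G w u)

  Adj-irrefl : ∀ {u} → ¬ Adj G u u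
  Adj-irrefl {u} e with () ← trans (sym (Graph.irrefl G u)) e

  reverse : ∀ {k} → InducedPath G k → InducedPath G k
  reverse P = record
    { path = record
      { vtx = vtx ∘ opposite
      ; inj = λ e → trans (sym (opposite-involutive _)) (trans (cong opposite (inj e)) (opposite-involutive _))
      ; consec = λ i j e → Adj-sym (consec (opposite j) (opposite i) (opposite-consecutive e))
      }
    ; noChord = λ i j a → unflip (noChord (opposite i) (opposite j) a)
    }
    where
    open InducedPath P
    back : ∀ {i j} → suc (toℕ (opposite i)) ≡ toℕ (opposite j) → suc (toℕ j) ≡ toℕ i
    back {i} {j} e = subst₂ (λ a b → suc (toℕ a) ≡ toℕ b) (opposite-involutive j) (opposite-involutive i)
                       (opposite-consecutive e)
    unflip : ∀ {i j} →
             suc (toℕ (opposite i)) ≡ toℕ (opposite j) ⊎ suc (toℕ (opposite j)) ≡ toℕ (opposite i) →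
             suc (toℕ i) ≡ toℕ j ⊎ suc (toℕ j) ≡ toℕ i
    unflip (inj₁ e) = inj₂ (back e)
    unflip (inj₂ e) = inj₁ (back e)

  edgePath : ∀ {u w} → u ≢ w → Adj G u w → InducedPath G 1
  edgePath {u} {w} u≢w uw = record
    { path = record { vtx = vtx ; inj = inj ; consec = consec }
    ; noChord = noChord
    }
    where
    vtx : Fin 2 → V G
    vtx fzero = u
    vtx (fsuc _) = w
    inj : ∀ {i j} → vtx i ≡ vtx j → i ≡ j
    inj {fzero} {fzero} _ = refl
    inj {fzero} {fsuc fzero} e = ⊥-elim (u≢w e)
    inj {fsuc fzero} {fzero} e = ⊥-elim (u≢w (sym e))
    inj {fsuc fzero} {fsuc fzero} _ = refl
    consec : ∀ i j → suc (toℕ i) ≡ toℕ j → Adj G (vtx i) (vtx j)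
    consec fzero (fsuc fzero) _ = uw
    noChord : ∀ i j → Adj G (vtx i) (vtx j) → suc (toℕ i) ≡ toℕ j ⊎ suc (toℕ j) ≡ toℕ i
    noChord fzero fzero a = ⊥-elim (Adj-irrefl a)
    noChord fzero (fsuc fzero) _ = inj₁ refl
    noChord (fsuc fzero) fzero _ = inj₂ refl
    noChord (fsuc fzero) (fsuc fzero) a = ⊥-elim (Adj-irrefl a)

  closingHole : ∀ {l} (P : InducedPath G l) (x : V G) → 2 ≤ l →
                (∀ i → x ≢ InducedPath.vtx P i) →
                Adj G x (InducedPath.vtx P fzero) → Adj G x (InducedPath.vtx P (fromℕ l)) →
                (∀ i → Adj G x (InducedPath.vtx P i) → toℕ i ≡ 0 ⊎ toℕ i ≡ l) →
                Hole G
  closingHole {l} P x 2≤l x∉P x-first x-last x-ends = record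
    { len = suc (suc l) ; len≥4 = s≤s (s≤s 2≤l) ; cyc = cyc ; inj = inj
    ; edges = edges ; induced = induced }
    where
    open InducedPath P using (vtx; consec; noChord)
    cyc : Fin (suc (suc l)) → V G
    cyc fzero = x
    cyc (fsuc i) = vtx i

    inj : ∀ {i j} → cyc i ≡ cyc j → i ≡ j
    inj {fzero} {fzero} _ = refl
    inj {fzero} {fsuc j} e = ⊥-elim (x∉P j e)
    inj {fsuc i} {fzero} e = ⊥-elim (x∉P i (sym e))
    inj {fsuc i} {fsuc j} e = cong fsuc (InducedPath.inj P e)

    edge-x : ∀ j → CycAdj G (suc (suc l)) fzero (fsuc j) → Adj G x (vtx j)
    edge-x j (inj₁ e) =
      subst (λ k → Adj G x (vtx k)) (sym (toℕ-injective (sym (suc-injective e)))) x-first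
    edge-x j (inj₂ (inj₂ (inj₁ (_ , e)))) =
      subst (λ k → Adj G x (vtx k))
            (toℕ-injective (trans (toℕ-fromℕ l) (sym (suc-injective (suc-injective e))))) x-last

    edges : ∀ i j → CycAdj G (suc (suc l)) i j → Adj G (cyc i) (cyc j)
    edges fzero fzero (inj₂ (inj₂ (inj₁ (_ , ()))))
    edges fzero fzero (inj₂ (inj₂ (inj₂ (_ , ()))))
    edges fzero (fsuc j) c = edge-x j c
    edges (fsuc i) fzero c = Adj-sym (edge-x i (Consecutive-sym c))
    edges (fsuc i) (fsuc j) (inj₁ e) = consec i j (suc-injective e)
    edges (fsuc i) (fsuc j) (inj₂ (inj₁ e)) = Adj-sym (consec j i (suc-injective e))
    edges (fsuc i) (fsuc j) (inj₂ (inj₂ (inj₁ (() , _))))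
    edges (fsuc i) (fsuc j) (inj₂ (inj₂ (inj₂ (() , _))))

    induced-x : ∀ j → Adj G x (vtx j) → CycAdj G (suc (suc l)) fzero (fsuc j)
    induced-x j a with x-ends j a
    ... | inj₁ e = inj₁ (cong suc (sym e))
    ... | inj₂ e = inj₂ (inj₂ (inj₁ (refl , cong (suc ∘ suc) e)))

    induced : ∀ i j → Adj G (cyc i) (cyc j) → CycAdj G (suc (suc l)) i j
    induced fzero fzero a = ⊥-elim (Adj-irrefl a)
    induced fzero (fsuc j) a = induced-x j a
    induced (fsuc i) fzero a = Consecutive-sym (induced-x i (Adj-sym a))
    induced (fsuc i) (fsuc j) a with noChord i j a
    ... | inj₁ e = inj₁ (cong suc e)
    ... | inj₂ e = inj₂ (inj₁ (cong suc e))

module OnHole {G : Graph} (C : Hole G) where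
  open Hole C

  instance
    len-nonZero : NonZero len
    len-nonZero = >-nonZero (≤-trans (s≤s z≤n) len≥4)

  c : ℕ → V G
  c k = cyc (k mod len)

  reassoc : ∀ a b s → (a + (b + s)) mod len ≡ ((a + b) + s) mod len
  reassoc a b s = cong (_mod len) (sym (+-assoc a b s))

  OneOf : ℕ → ℕ → ℕ → Fin len → Set
  OneOf p q r j = j ≡ p mod len ⊎ j ≡ q mod len ⊎ j ≡ r mod len

  c-toℕ : ∀ j → c (toℕ j) ≡ cyc j
  c-toℕ j = cong cyc (mod-toℕ j)

  c-periodic : ∀ k → c (len + k) ≡ c k
  c-periodic k = cong cyc (mod-periodic k)

  Adj-c-suc : ∀ k → Adj G (c k) (c (suc k))
  Adj-c-suc k = edges _ _ (Consecutive-mod-suc k)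

  c-injective : ∀ s {a b} → a < len → b < len → c (a + s) ≡ c (b + s) → a ≡ b
  c-injective s a<m b<m e = mod-injective a<m b<m (mod-cancelʳ-+ s (inj e))

  c-consecutive : ∀ s {a b} → a < len → b < len → Adj G (c (a + s)) (c (b + s)) → Consecutive len a b
  c-consecutive s {a} {b} a<m b<m ab with Consecutive⇒suc-mod (induced _ _ ab)
  ... | inj₁ e with suc-mod-cases a<m b<m (mod-cancelʳ-+ s (trans (sym (suc-mod-toℕ (a + s))) e))
  ...   | inj₁ 1+a≡b = inj₁ 1+a≡b
  ...   | inj₂ wrap  = inj₂ (inj₂ (inj₂ wrap))
  c-consecutive s {a} {b} a<m b<m ab | inj₂ e
        with suc-mod-cases b<m a<m (mod-cancelʳ-+ s (trans (sym (suc-mod-toℕ (b + s))) e))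
  ...   | inj₁ 1+b≡a = inj₂ (inj₁ 1+b≡a)
  ...   | inj₂ wrap  = inj₂ (inj₂ (inj₁ wrap))

  arc : ∀ s l → suc l < len → InducedPath G l
  arc s l 1+l<m = record
    { path = record
      { vtx = λ i → c (toℕ i + s)
      ; inj = λ {i} {j} e → toℕ-injective (c-injective s (in-range i) (in-range j) e)
      ; consec = λ i j e → subst (λ k → Adj G (c (toℕ i + s)) (c (k + s))) e (Adj-c-suc (toℕ i + s))
      }
    ; noChord = noChord
    }
    where
    in-range : ∀ (i : Fin (suc l)) → toℕ i < len
    in-range i = <-trans (toℕ<n i) 1+l<m
    noChord : ∀ i j → Adj G (c (toℕ i + s)) (c (toℕ j + s)) →
              suc (toℕ i) ≡ toℕ j ⊎ suc (toℕ j) ≡ toℕ i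
    noChord i j a with c-consecutive s (in-range i) (in-range j) a
    ... | inj₁ e = inj₁ e
    ... | inj₂ (inj₁ e) = inj₂ e
    ... | inj₂ (inj₂ (inj₁ (_ , e))) = ⊥-elim (<-irrefl e (≤-<-trans (toℕ<n j) 1+l<m))
    ... | inj₂ (inj₂ (inj₂ (_ , e))) = ⊥-elim (<-irrefl e (≤-<-trans (toℕ<n i) 1+l<m))

  module _ (x : V G) where

    Covers : ℕ → ℕ → ℕ → Set
    Covers p q r = ∀ j → Adj G x (cyc j) → OneOf p q r j

    window-not-major : ∀ s → Covers s (suc s) (suc (suc s)) → ¬ Major G C x
    window-not-major s covered major =
      major (s mod len , suc s mod len , suc (suc s) mod len ,
             Consecutive-mod-suc s , Consecutive-mod-suc (suc s) , ends-differ , covered)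
      where
      ends-differ : s mod len ≢ suc (suc s) mod len
      ends-differ e with () ← mod-injective (>-nonZero⁻¹ len) (≤-trans (s≤s (s≤s (s≤s z≤n))) len≥4)
                                (mod-cancelʳ-+ s {0} {2} e)

    major-outside : Major G C x → ∀ j → x ≢ cyc j
    major-outside major j refl = window-not-major s covered major
      where
      -- position j - 1, read modulo len
      s = pred len + toℕ j
      lift : ∀ t → (t + suc s) mod len ≡ (t + toℕ j) mod len
      lift t = trans (cong (_mod len) (begin
        t + suc s             ≡⟨ cong (λ z → t + (z + toℕ j)) (suc-pred len) ⟩
        t + (len + toℕ j)     ≡⟨ solve 3 (λ t l k → t :+ (l :+ k) := l :+ (t :+ k)) refl t len (toℕ j) ⟩
        len + (t + toℕ j)     ∎)) (mod-periodic (t + toℕ j))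
        where open ≡-Reasoning
      covered : Covers s (suc s) (suc (suc s))
      covered i a with Consecutive⇒suc-mod (induced j i a)
      ... | inj₁ e = inj₂ (inj₂ (trans (sym e) (sym (lift 1))))
      ... | inj₂ e = inj₁ (trans (sym (mod-toℕ i))
                             (mod-cancelˡ-+ 1 (trans e (trans (sym (mod-toℕ j)) (sym (lift 0))))))

    -- Gaps may be 0, so one or two neighbours on C are described as well.
    record Gaps (s g₁ g₂ g₃ : ℕ) : Set where
      field
        total  : g₁ + g₂ + g₃ ≡ len
        adj₀   : Adj G x (c s)
        adj₁   : Adj G x (c (g₁ + s))
        adj₂   : Adj G x (c (g₂ + (g₁ + s)))
        covers : Covers s (g₁ + s) (g₂ + (g₁ + s))

    rotate : ∀ {s g₁ g₂ g₃} → Gaps s g₁ g₂ g₃ → Gaps (g₁ + s) g₂ g₃ g₁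
    rotate {s} {g₁} {g₂} {g₃} γ = record
      { total = trans (solve 3 (λ a b d → b :+ d :+ a := a :+ b :+ d) refl g₁ g₂ g₃) total
      ; adj₀ = adj₁
      ; adj₁ = adj₂
      ; adj₂ = subst (Adj G x ∘ cyc) (sym around) adj₀
      ; covers = λ j a → cycle (covers j a)
      }
      where
      open Gaps γ
      around : (g₃ + (g₂ + (g₁ + s))) mod len ≡ s mod len
      around = trans (cong (_mod len) (begin
        g₃ + (g₂ + (g₁ + s))   ≡⟨ solve 4 (λ a b d t → d :+ (b :+ (a :+ t)) := a :+ b :+ d :+ t) refl g₁ g₂ g₃ s ⟩
        g₁ + g₂ + g₃ + s       ≡⟨ cong (_+ s) total ⟩
        len + s                ∎)) (mod-periodic s)
        where open ≡-Reasoning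
      cycle : ∀ {j} → OneOf s (g₁ + s) (g₂ + (g₁ + s)) j →
              OneOf (g₁ + s) (g₂ + (g₁ + s)) (g₃ + (g₂ + (g₁ + s))) j
      cycle (inj₁ e) = inj₂ (inj₂ (trans e (sym around)))
      cycle (inj₂ (inj₁ e)) = inj₁ e
      cycle (inj₂ (inj₂ e)) = inj₂ (inj₁ e)

    neighbour-offset : ∀ {s g₁ g₂ g₃} → Gaps s g₁ g₂ g₃ → ∀ t → Adj G x (c (t + s)) →
                       OneOf 0 g₁ (g₂ + g₁) (t mod len)
    neighbour-offset {s} {g₁} {g₂} γ t a with Gaps.covers γ _ a
    ... | inj₁ e = inj₁ (mod-cancelʳ-+ s e)
    ... | inj₂ (inj₁ e) = inj₂ (inj₁ (mod-cancelʳ-+ s e))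
    ... | inj₂ (inj₂ e) = inj₂ (inj₂ (mod-cancelʳ-+ s (trans e (reassoc g₂ g₁ s))))

    gaps-window : ∀ {s g₁ g₂ g₃} → g₁ + g₂ ≤ 2 → Gaps s g₁ g₂ g₃ → ¬ Major G C x
    gaps-window {s} {g₁} {g₂} g₁+g₂≤2 γ = window-not-major s (λ j a → place (Gaps.covers γ j a))
      where
      near : ∀ {t j} → t ≤ 2 → j ≡ (t + s) mod len → OneOf s (suc s) (suc (suc s)) j
      near z≤n e = inj₁ e
      near (s≤s z≤n) e = inj₂ (inj₁ e)
      near (s≤s (s≤s z≤n)) e = inj₂ (inj₂ e)
      place : ∀ {j} → OneOf s (g₁ + s) (g₂ + (g₁ + s)) j → OneOf s (suc s) (suc (suc s)) j
      place (inj₁ e) = inj₁ e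
      place (inj₂ (inj₁ e)) = near (m+n≤o⇒m≤o g₁ g₁+g₂≤2) e
      place (inj₂ (inj₂ e)) = near (subst (_≤ 2) (+-comm g₁ g₂) g₁+g₂≤2) (trans e (reassoc g₂ g₁ s))

    gap-hole : ∀ {s g₁ g₂ g₃} → 2 ≤ g₁ → 2 ≤ g₂ + g₃ → (∀ j → x ≢ cyc j) →
               Gaps s g₁ g₂ g₃ → Hole G
    gap-hole {s} {g₁} {g₂} {g₃} 2≤g₁ 2≤g₂+g₃ outside γ =
      closingHole (arc s g₁ 1+g₁<len) x 2≤g₁ (λ i → outside _)
        adj₀ (subst (λ t → Adj G x (c (t + s))) (sym (toℕ-fromℕ g₁)) adj₁) ends
      where
      open Gaps γ
      g₂+g₁≤len : g₂ + g₁ ≤ len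
      g₂+g₁≤len = subst (_≤ len) (+-comm g₁ g₂) (subst (g₁ + g₂ ≤_) total (m≤m+n (g₁ + g₂) g₃))
      1+g₁<len : suc g₁ < len
      1+g₁<len = subst (_≤ len) (+-comm g₁ 2)
                   (subst (g₁ + 2 ≤_) (trans (sym (+-assoc g₁ g₂ g₃)) total) (+-monoʳ-≤ g₁ 2≤g₂+g₃))
      g₁<len : g₁ < len
      g₁<len = <-trans (n<1+n g₁) 1+g₁<len
      ends : ∀ i → Adj G x (c (toℕ i + s)) → toℕ i ≡ 0 ⊎ toℕ i ≡ g₁
      ends i a with neighbour-offset γ (toℕ i) a
      ... | inj₁ e =
        mod-endpoint g₁<len (≤-pred (toℕ<n i)) (<⇒≤ g₁<len) ≤-refl (trans e (sym mod-self))
      ... | inj₂ (inj₁ e) = mod-endpoint g₁<len (≤-pred (toℕ<n i)) ≤-refl (<⇒≤ g₁<len) e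
      ... | inj₂ (inj₂ e) = mod-endpoint g₁<len (≤-pred (toℕ<n i)) (m≤n+m g₁ g₂) g₂+g₁≤len e

    -- Apex c (q + s); P₁ runs forward and P₂ backward along C to the triangle c (p + (q + s)), c s, x.
    module GapsPyramid {s q p} (2≤q : 2 ≤ q) (2≤p : 2 ≤ p) (outside : ∀ j → x ≢ cyc j)
                       (γ : Gaps s q p 1) where
      open Gaps γ

      closes : suc (p + q) ≡ len
      closes = trans (solve 2 (λ q p → con 1 :+ (p :+ q) := q :+ p :+ con 1) refl q p) total

      p+q<len : p + q < len
      p+q<len = ≤-reflexive closes

      0<q : 0 < q
      0<q = ≤-trans (s≤s z≤n) 2≤q

      0<p : 0 < p
      0<p = ≤-trans (s≤s z≤n) 2≤p

      q<len : q < len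
      q<len = ≤-<-trans (m≤n+m q p) p+q<len

      neighbour-positions : ∀ t → t < len → Adj G x (c (t + s)) → t ≡ 0 ⊎ t ≡ q ⊎ t ≡ p + q
      neighbour-positions t t<len a with neighbour-offset γ t a
      ... | inj₁ e = inj₁ (mod-injective t<len (>-nonZero⁻¹ len) e)
      ... | inj₂ (inj₁ e) = inj₂ (inj₁ (mod-injective t<len q<len e))
      ... | inj₂ (inj₂ e) = inj₂ (inj₂ (mod-injective t<len p+q<len e))

      P₁ : InducedPath G p
      P₁ = arc (q + s) p (≤-<-trans (m<m+n p 0<q) p+q<len)

      P₂ : InducedPath G q
      P₂ = reverse (arc s q (≤-<-trans (m<n+m q 0<p) p+q<len))

      P₃ : InducedPath G 1
      P₃ = edgePath (λ e → outside _ (sym e)) (Adj-sym {G = G} adj₁)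

      open InducedPath using (vtx)

      P₁-vtx : ∀ a → vtx P₁ a ≡ c ((toℕ a + q) + s)
      P₁-vtx a = cong c (sym (+-assoc (toℕ a) q s))

      P₂-vtx : ∀ b → vtx P₂ b ≡ c ((q ∸ toℕ b) + s)
      P₂-vtx b = cong (λ t → c (t + s)) (opposite-prop b)

      P₁-position≢0 : ∀ (a : Fin (suc p)) → toℕ a + q ≢ 0
      P₁-position≢0 a = m<n⇒n≢0 (≤-trans 0<q (m≤n+m q (toℕ a)))

      P₁-in-range : ∀ (a : Fin (suc p)) → toℕ a + q < len
      P₁-in-range a = ≤-<-trans (+-monoˡ-≤ q (≤-pred (toℕ<n a))) p+q<len

      P₂-in-range : ∀ (b : Fin (suc q)) → q ∸ toℕ b < len
      P₂-in-range b = ≤-<-trans (m∸n≤m q (toℕ b)) q<len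

      P₁-last : vtx P₁ (fromℕ p) ≡ c (p + (q + s))
      P₁-last = cong (λ t → c (t + (q + s))) (toℕ-fromℕ p)

      P₂-last : vtx P₂ (fromℕ q) ≡ c s
      P₂-last = begin
        vtx P₂ (fromℕ q)               ≡⟨ P₂-vtx (fromℕ q) ⟩
        c ((q ∸ toℕ (fromℕ q)) + s)    ≡⟨ cong (λ t → c ((q ∸ t) + s)) (toℕ-fromℕ q) ⟩
        c ((q ∸ q) + s)                ≡⟨ cong (λ t → c (t + s)) (n∸n≡0 q) ⟩
        c s                            ∎
        where open ≡-Reasoning

      meet-at-apex : ∀ {a : Fin (suc p)} {b : Fin (suc q)} → toℕ a + q ≡ q ∸ toℕ b →
             toℕ a ≡ 0 × toℕ b ≡ 0
      meet-at-apex {a} {b} e =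
        a≡0 , ∸-cancelˡ-≡ (≤-pred (toℕ<n b)) z≤n (trans (sym e) (cong (_+ q) a≡0))
        where
        a≡0 : toℕ a ≡ 0
        a≡0 = n≤0⇒n≡0 (+-cancelʳ-≤ q (toℕ a) 0 (subst (_≤ q) (sym e) (m∸n≤m q (toℕ b))))

      disjoint₁₂ : ∀ a b → vtx P₁ a ≡ vtx P₂ b → toℕ a ≡ 0 × toℕ b ≡ 0
      disjoint₁₂ a b e = meet-at-apex
        (c-injective s (P₁-in-range a) (P₂-in-range b) (trans (sym (P₁-vtx a)) (trans e (P₂-vtx b))))

      disjoint₁₃ : ∀ a b → vtx P₁ a ≡ vtx P₃ b → toℕ a ≡ 0 × toℕ b ≡ 0
      disjoint₁₃ a fzero e = proj₁ (meet-at-apex {a} {fzero}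
        (c-injective s (P₁-in-range a) q<len (trans (sym (P₁-vtx a)) e))) , refl
      disjoint₁₃ a (fsuc fzero) e = ⊥-elim (outside _ (sym e))

      disjoint₂₃ : ∀ a b → vtx P₂ a ≡ vtx P₃ b → toℕ a ≡ 0 × toℕ b ≡ 0
      disjoint₂₃ b fzero e = proj₂ (meet-at-apex {fzero} {b}
        (sym (c-injective s (P₂-in-range b) q<len (trans (sym (P₂-vtx b)) e)))) , refl
      disjoint₂₃ b (fsuc fzero) e = ⊥-elim (outside _ (sym e))

      wrap-edge : Adj G (vtx P₁ (fromℕ p)) (vtx P₂ (fromℕ q))
      wrap-edge = subst₂ (Adj G) (sym P₁-last) (sym P₂-last)
                    (subst (Adj G (c (p + (q + s)))) (trans (cong c around) (c-periodic s))
                           (Adj-c-suc (p + (q + s))))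
        where
        around : suc (p + (q + s)) ≡ len + s
        around = trans (cong suc (sym (+-assoc p q s))) (cong (_+ s) closes)

      only₁₂ : ∀ a b → 1 ≤ toℕ a → 1 ≤ toℕ b → Adj G (vtx P₁ a) (vtx P₂ b) →
               toℕ a ≡ p × toℕ b ≡ q
      only₁₂ a b 1≤a 1≤b ab
        with c-consecutive s (P₁-in-range a) (P₂-in-range b) (subst₂ (Adj G) (P₁-vtx a) (P₂-vtx b) ab)
      ... | inj₁ e = ⊥-elim (<⇒≢ (s≤s (≤-trans (m∸n≤m q (toℕ b)) (m≤n+m q (toℕ a)))) (sym e))
      ... | inj₂ (inj₁ e) = ⊥-elim (<⇒≢ (≤-<-trans (∸-monoʳ-< 1≤b (≤-pred (toℕ<n b))) (m<n+m q 1≤a)) e)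
      ... | inj₂ (inj₂ (inj₁ (e , _))) = ⊥-elim (P₁-position≢0 a e)
      ... | inj₂ (inj₂ (inj₂ (e₀ , e₁))) =
        +-cancelʳ-≡ q (toℕ a) p (suc-injective (trans e₁ (sym closes))) ,
        ≤-antisym (≤-pred (toℕ<n b)) (m∸n≡0⇒m≤n e₀)

      only₁₃ : ∀ a b → 1 ≤ toℕ a → 1 ≤ toℕ b → Adj G (vtx P₁ a) (vtx P₃ b) →
               toℕ a ≡ p × toℕ b ≡ 1
      only₁₃ a (fsuc fzero) 1≤a _ ax
        with neighbour-positions (toℕ a + q) (P₁-in-range a)
               (subst (Adj G x) (P₁-vtx a) (Adj-sym {G = G} ax))
      ... | inj₁ e = ⊥-elim (P₁-position≢0 a e)
      ... | inj₂ (inj₁ e) = ⊥-elim (<⇒≢ (m<n+m q 1≤a) (sym e))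
      ... | inj₂ (inj₂ e) = +-cancelʳ-≡ q (toℕ a) p e , refl

      only₂₃ : ∀ a b → 1 ≤ toℕ a → 1 ≤ toℕ b → Adj G (vtx P₂ a) (vtx P₃ b) →
               toℕ a ≡ q × toℕ b ≡ 1
      only₂₃ b (fsuc fzero) 1≤b _ bx
        with neighbour-positions (q ∸ toℕ b) (P₂-in-range b)
               (subst (Adj G x) (P₂-vtx b) (Adj-sym {G = G} bx))
      ... | inj₁ e = ≤-antisym (≤-pred (toℕ<n b)) (m∸n≡0⇒m≤n e) , refl
      ... | inj₂ (inj₁ e) = ⊥-elim (<⇒≢ (∸-monoʳ-< 1≤b (≤-pred (toℕ<n b))) e)
      ... | inj₂ (inj₂ e) = ⊥-elim (<⇒≢ (≤-<-trans (m∸n≤m q (toℕ b)) (m<n+m q 0<p)) e)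

      pyramid : Pyramid G
      pyramid = record
        { k₁ = p ; k₂ = q ; k₃ = 1 ; P₁ = P₁ ; P₂ = P₂ ; P₃ = P₃
        ; same₀₂ = cong (λ t → c (t + s)) (toℕ-fromℕ q) ; same₀₃ = refl
        ; k₁≥1 = 0<p ; k₂≥1 = 0<q ; k₃≥1 = ≤-refl
        ; twoLong = inj₁ (2≤p , 2≤q)
        ; disj₁₂ = disjoint₁₂ ; disj₁₃ = disjoint₁₃ ; disj₂₃ = disjoint₂₃
        ; e₁₂ = wrap-edge
        ; e₁₃ = subst (λ u → Adj G u x) (sym P₁-last) (Adj-sym {G = G} adj₂)
        ; e₂₃ = subst (λ u → Adj G u x) (sym P₂-last) (Adj-sym {G = G} adj₀)
        ; only₁₂ = only₁₂ ; only₁₃ = only₁₃ ; only₂₃ = only₂₃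
        }

    sorted-gaps : ∀ {a b d : Fin len} → toℕ a ≤ toℕ b → toℕ b ≤ toℕ d →
                  Adj G x (cyc a) → Adj G x (cyc b) → Adj G x (cyc d) →
                  (∀ j → Adj G x (cyc j) → j ≡ a ⊎ j ≡ b ⊎ j ≡ d) →
                  Gaps (toℕ a) (toℕ b ∸ toℕ a) (toℕ d ∸ toℕ b)
                       (len ∸ ((toℕ b ∸ toℕ a) + (toℕ d ∸ toℕ b)))
    sorted-gaps {a} {b} {d} a≤b b≤d xa xb xd covered = record
      { total = m+[n∸m]≡n (≤-trans span (<⇒≤ (toℕ<n d)))
      ; adj₀ = subst (Adj G x) (sym (c-toℕ a)) xa
      ; adj₁ = subst (Adj G x) (sym (trans (cong c reach-b) (c-toℕ b))) xb
      ; adj₂ = subst (Adj G x) (sym (trans (cong c reach-d) (c-toℕ d))) xd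
      ; covers = λ j a → position (covered j a)
      }
      where
      g₁ = toℕ b ∸ toℕ a
      g₂ = toℕ d ∸ toℕ b
      reach-b : g₁ + toℕ a ≡ toℕ b
      reach-b = m∸n+n≡m a≤b
      reach-d : g₂ + (g₁ + toℕ a) ≡ toℕ d
      reach-d = trans (cong (g₂ +_) reach-b) (m∸n+n≡m b≤d)
      span : g₁ + g₂ ≤ toℕ d
      span = subst₂ _≤_ (+-comm g₂ g₁) reach-d (+-monoʳ-≤ g₂ (m≤m+n g₁ (toℕ a)))
      at : ∀ {t} (k : Fin len) → t ≡ toℕ k → k ≡ t mod len
      at k refl = sym (mod-toℕ k)
      position : ∀ {j} → j ≡ a ⊎ j ≡ b ⊎ j ≡ d → OneOf (toℕ a) (g₁ + toℕ a) (g₂ + (g₁ + toℕ a)) j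
      position (inj₁ refl) = inj₁ (at a refl)
      position (inj₂ (inj₁ refl)) = inj₂ (inj₁ (at b reach-b))
      position (inj₂ (inj₂ refl)) = inj₂ (inj₂ (at d reach-d))

    adjacent? : ∀ j → Dec (T (Graph.adj G x (cyc j)))
    adjacent? j = T? (Graph.adj G x (cyc j))

    -- numNbrsIn G C x is length neighbours by definition.
    neighbours : List (Fin len)
    neighbours = filterᵇ (λ j → Graph.adj G x (cyc j)) (allFin len)

    neighbours-sorted : AllPairs Fin._<_ neighbours
    neighbours-sorted = filter⁺ adjacent? (tabulate⁺-< id)

    ∈-neighbours⁺ : ∀ j → Adj G x (cyc j) → j ∈ neighbours
    ∈-neighbours⁺ j a = ∈-filter⁺ adjacent? (∈-allFin j) (Equivalence.from T-≡ a)

    ∈-neighbours⁻ : ∀ j → j ∈ neighbours → Adj G x (cyc j)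
    ∈-neighbours⁻ j j∈ = Equivalence.to T-≡ (proj₂ (∈-filter⁻ adjacent? {xs = allFin len} j∈))

    module _ (major : Major G C x) (noPyramid : ¬ Pyramid G)
             (oddLen : Odd G len) (shortest : ∀ D → OddHole G D → len ≤ Hole.len D) where

      odd-first-gap-impossible : ∀ {s g₁ g₂ g₃} → Odd G g₁ → Gaps s g₁ g₂ g₃ → ⊥
      odd-first-gap-impossible {g₂ = g₂} {g₃} (zero , refl) γ with g₂ ≤? 1 | g₃ ≤? 1
      ... | yes g₂≤1 | _ = gaps-window (s≤s g₂≤1) γ major
      ... | no _ | yes g₃≤1 = gaps-window (+-monoˡ-≤ 1 g₃≤1) (rotate (rotate γ)) major
      ... | no g₂≰1 | no g₃≰1 =
        noPyramid (GapsPyramid.pyramid (≰⇒> g₂≰1) (≰⇒> g₃≰1) (major-outside major) (rotate γ))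
      odd-first-gap-impossible {g₁ = g₁} {g₂} {g₃} (suc k , refl) γ with 3 ≤? g₂ + g₃
      ... | no 3≰g₂+g₃ = gaps-window (≤-pred (≰⇒> 3≰g₂+g₃)) (rotate γ) major
      ... | yes 3≤g₂+g₃ = <⇒≱ shorter (shortest hole (Odd-+2 {G} (suc k , refl)))
        where
        hole : Hole G
        hole = gap-hole (s≤s (s≤s z≤n)) (≤-trans (n≤1+n 2) 3≤g₂+g₃) (major-outside major) γ
        shorter : suc (suc g₁) < len
        shorter = subst (3 + g₁ ≤_) (Gaps.total (rotate γ)) (+-monoˡ-≤ g₁ 3≤g₂+g₃)

      gaps-impossible : ∀ {s g₁ g₂ g₃} → Gaps s g₁ g₂ g₃ → ⊥
      gaps-impossible {g₁ = g₁} {g₂} {g₃} γ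
        with even-or-odd {G} g₁ | even-or-odd {G} g₂ | even-or-odd {G} g₃
      ... | inj₂ odd₁ | _ | _ = odd-first-gap-impossible odd₁ γ
      ... | _ | inj₂ odd₂ | _ = odd-first-gap-impossible odd₂ (rotate γ)
      ... | _ | _ | inj₂ odd₃ = odd-first-gap-impossible odd₃ (rotate (rotate γ))
      ... | inj₁ even₁ | inj₁ even₂ | inj₁ even₃ =
        even-not-odd {G} (subst Even (Gaps.total γ) (Even-+ (Even-+ even₁ even₂) even₃)) oddLen

      few-neighbours-impossible : ∀ {xs} → AllPairs Fin._<_ xs → length xs ≤ 3 →
                      (∀ j → Adj G x (cyc j) → j ∈ xs) → (∀ j → j ∈ xs → Adj G x (cyc j)) → ⊥
      few-neighbours-impossible {[]} _ _ complete _ =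
        window-not-major 0 (λ j a → ⊥-elim (¬Any[] (complete j a))) major
      few-neighbours-impossible {a ∷ []} _ _ complete sound =
        gaps-impossible (sorted-gaps ≤-refl ≤-refl xa xa xa covered)
        where
        xa = sound a (here refl)
        covered : ∀ j → Adj G x (cyc j) → j ≡ a ⊎ j ≡ a ⊎ j ≡ a
        covered j xj with complete j xj
        ... | here e = inj₁ e
      few-neighbours-impossible {a ∷ b ∷ []} ((a<b ∷ []) ∷ _) _ complete sound =
        gaps-impossible (sorted-gaps (<⇒≤ a<b) ≤-refl (sound a (here refl)) xb xb covered)
        where
        xb = sound b (there (here refl))
        covered : ∀ j → Adj G x (cyc j) → j ≡ a ⊎ j ≡ b ⊎ j ≡ b
        covered j xj with complete j xj
        ... | here e = inj₁ e
        ... | there (here e) = inj₂ (inj₁ e)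
      few-neighbours-impossible {a ∷ b ∷ d ∷ []} ((a<b ∷ _) ∷ (b<d ∷ []) ∷ _) _ complete sound =
        gaps-impossible (sorted-gaps (<⇒≤ a<b) (<⇒≤ b<d)
                   (sound a (here refl)) (sound b (there (here refl))) (sound d (there (there (here refl)))) covered)
        where
        covered : ∀ j → Adj G x (cyc j) → j ≡ a ⊎ j ≡ b ⊎ j ≡ d
        covered j xj with complete j xj
        ... | here e = inj₁ e
        ... | there (here e) = inj₂ (inj₁ e)
        ... | there (there (here e)) = inj₂ (inj₂ e)
      few-neighbours-impossible {_ ∷ _ ∷ _ ∷ _ ∷ _} _ (s≤s (s≤s (s≤s ()))) _ _

      four-neighbours : 4 ≤ numNbrsIn G C x
      four-neighbours with 4 ≤? numNbrsIn G C x
      ... | yes 4≤n = 4≤n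
      ... | no 4≰n =
        ⊥-elim (few-neighbours-impossible neighbours-sorted (≤-pred (≰⇒> 4≰n)) ∈-neighbours⁺ ∈-neighbours⁻)

mainTheorem4 : (G : Graph) → Candidate G → (C : Hole G) → ShortestOddHole G C →
    (v : V G) → Major G C v → 4 ≤ numNbrsIn G C v
mainTheorem4 G (noPyramid , _ , _) C (oddLen , shortest) v major =
  OnHole.four-neighbours C v major noPyramid oddLen shortest
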